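{- For all integers $m,n\ge 0$, $$|\mathcal{D}^*(m,n)|=|\mathcal{C}^*(m,n)|,$$ and consequently $$|\mathcal{D}^*(m,n)|=|\mathcal{D}(m,n-2m)|.$$
   Context: A Schur partition is a partition of an integer into positive parts such that any two consecutive parts (in sorted order) differ by at least $3$, and no two consecutive parts differing by exactly $3$ are both multiples of $3$. For a partition $\pi$, let $m(\pi)$ denote the number of parts of $\pi$ plus the number of even parts of $\pi$. $\mathcal{D}(m,n)$ is the set of Schur partitions $\pi$ of $n$ with $m(\pi)=m$; $\mathcal{D}^*(m,n)$ is the subset of $\mathcal{D}(m,n)$ in which every odd part is $\ge 3$ and every even part is $\ge 6$. $\mathcal{C}(m,n)$ is the set of partitions of $n$ into exactly $m$ odd parts, each part occurring at most twice; $\mathcal{C}^*(m,n)$ is the subset of $\mathcal{C}(m,n)$ in which every part is $>1$. Sets with negative $n$ are empty. -}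

module Defs where

open import Data.Bool using (Bool; true; false; _∧_; _∨_; not; T)
open import Data.Nat using (ℕ; zero; suc; _+_; _*_; _≤ᵇ_; _≡ᵇ_; _<ᵇ_; _%_)
open import Data.List using (List; []; _∷_; length)
open import Data.Nat.ListAction using (sum)
open import Data.Product using (Σ)

-- Partitions are represented as lists of natural numbers sorted in
-- weakly increasing order (smallest part first), all parts positive.

isEven : ℕ → Bool
isEven k = (k % 2) ≡ᵇ 0

isOdd : ℕ → Bool
isOdd k = not (isEven k)

div3 : ℕ → Bool
div3 k = (k % 3) ≡ᵇ 0

allB : (ℕ → Bool) → List ℕ → Bool
allB p []       = true
allB p (x ∷ xs) = p x ∧ allB p xs

linkedB : (ℕ → ℕ → Bool) → List ℕ → Bool
linkedB r []           = true
linkedB r (x ∷ [])     = true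
linkedB r (x ∷ y ∷ xs) = r x y ∧ linkedB r (y ∷ xs)

isPartition : List ℕ → Bool
isPartition π = allB (λ k → 1 ≤ᵇ k) π ∧ linkedB _≤ᵇ_ π

numEven : List ℕ → ℕ
numEven []       = 0
numEven (x ∷ xs) with isEven x
... | true  = suc (numEven xs)
... | false = numEven xs

mStat : List ℕ → ℕ
mStat π = length π + numEven π

schurStep : ℕ → ℕ → Bool
schurStep a b = ((a + 3) ≤ᵇ b) ∧ not ((b ≡ᵇ (a + 3)) ∧ div3 a ∧ div3 b)

isSchur : List ℕ → Bool
isSchur π = isPartition π ∧ linkedB schurStep π

inD : ℕ → ℕ → List ℕ → Bool
inD m n π = isSchur π ∧ (sum π ≡ᵇ n) ∧ (mStat π ≡ᵇ m)

starCond : ℕ → Bool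
starCond k = (isOdd k ∧ (3 ≤ᵇ k)) ∨ (isEven k ∧ (6 ≤ᵇ k))

inDStar : ℕ → ℕ → List ℕ → Bool
inDStar m n π = inD m n π ∧ allB starCond π

-- no part occurs three or more times (list is sorted, so check triples)
atMostTwice : List ℕ → Bool
atMostTwice (x ∷ y ∷ z ∷ xs) = not ((x ≡ᵇ y) ∧ (y ≡ᵇ z)) ∧ atMostTwice (y ∷ z ∷ xs)
atMostTwice _ = true

inC : ℕ → ℕ → List ℕ → Bool
inC m n π = isPartition π ∧ allB isOdd π ∧ atMostTwice π
            ∧ (sum π ≡ᵇ n) ∧ (length π ≡ᵇ m)

inCStar : ℕ → ℕ → List ℕ → Bool
inCStar m n π = inC m n π ∧ allB (λ k → 1 <ᵇ k) π

𝒟 : ℕ → ℕ → Set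
𝒟 m n = Σ (List ℕ) (λ π → T (inD m n π))

𝒟* : ℕ → ℕ → Set
𝒟* m n = Σ (List ℕ) (λ π → T (inDStar m n π))

𝒞 : ℕ → ℕ → Set
𝒞 m n = Σ (List ℕ) (λ π → T (inC m n π))

𝒞* : ℕ → ℕ → Set
𝒞* m n = Σ (List ℕ) (λ π → T (inCStar m n π))

module Submission where

-- Order the parts increasingly and split off the smallest one.  For even j ≥ 2, Schur
-- partitions with parts ≥ j in which a part x counts x + 2 (x odd) or x + 4 (x even)
-- towards the size correspond, keeping m, to Schur partitions with parts ≥ j + 3: splitting
-- off the smallest part twice on both sides produces matching pieces, and induction on the
-- size finishes.  A partition in 𝒟* has all parts ≥ 5, or is a 3 followed by parts ≥ 7;
-- applying the correspondence at j = 2 and j = 4 to the cases "smallest part ≥ 2" and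
-- "a 1 followed by parts ≥ 4" of the twisted partitions gives 𝒟*(m,n) ≅ 𝒟(m,n−2m).
-- Splitting off the parts 1, …, 4 of any Schur partition gives 𝒟(m,n) ≅ ⊔_{k≤2} 𝒟*(m−k,n−k),
-- just as counting the parts equal to 1 gives 𝒞(m,n) ≅ ⊔_{k≤2} 𝒞*(m−k,n−k), while
-- subtracting 2 from every part gives 𝒞*(m,n) ≅ 𝒞(m,n−2m).  Strong induction on n then
-- yields 𝒟 ≅ 𝒞, and 𝒟*(m,n) ≅ 𝒟(m,n−2m) ≅ 𝒞(m,n−2m) ≅ 𝒞*(m,n).

open import Defs
open import Data.Nat using (ℕ; _*_; _∸_; _≤_; _<_)
open import Data.Empty using (⊥)
open import Data.Product using (_×_)
open import Function.Bundles using (_↔_)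

open import Level using (0ℓ)
open import Algebra.Bundles using (CommutativeMonoid)
import Algebra.Properties.CommutativeSemigroup as CommutativeSemigroupProperties
open import Data.Bool using (Bool; true; false; _∧_; _∨_; not; T; if_then_else_)
open import Data.Bool.Properties using (T-irrelevant; T-∧; T-∨; not-involutive)
open import Data.Empty using (⊥-elim)
open import Data.List using (List; []; _∷_; length; map)
open import Data.List.Properties using (map-∘; map-id)
open import Data.Nat using (zero; suc; _+_; _≤ᵇ_; _≡ᵇ_; _<ᵇ_; z≤n; s≤s; s≤s⁻¹; _%_)
open import Data.Nat.DivMod using ([m+n]%n≡m%n)
open import Data.Nat.Induction using (<-rec)
open import Data.Nat.ListAction using (sum)
open import Data.Nat.Properties
open import Data.Nat.Tactic.RingSolver using (solve-∀)
open import Data.Product using (Σ; _,_; proj₁; proj₂)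
open import Data.Product.Function.Dependent.Propositional using (Σ-↔)
open import Data.Sum using (_⊎_; inj₁; inj₂; [_,_]′)
open import Data.Sum.Function.Propositional using (_⊎-cong_)
open import Data.Unit using (tt)
open import Function.Bundles using (mk↔ₛ′; Equivalence)
open import Function.Properties.Inverse using (↔-refl; ↔-sym; ↔-trans)
open import Function.Related.Propositional using (bijection; module EquationalReasoning)
open import Function.Related.TypeIsomorphisms using (⊎-commutativeMonoid)
open import Relation.Binary.PropositionalEquality
open import Relation.Nullary using (Dec; yes; no; ¬_)
open import Algebra.Properties.CommutativeSemigroup +-commutativeSemigroup using (x∙yz≈y∙xz)
open import Algebra.Solver.CommutativeMonoid (⊎-commutativeMonoid bijection 0ℓ)
  using (solve; _⊜_; _⊕_)
module ⊎-Props = CommutativeSemigroupProperties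
  (CommutativeMonoid.commutativeSemigroup (⊎-commutativeMonoid bijection 0ℓ))

infixr 2 _⟫_
_⟫_ : {A B C : Set} → A ↔ B → B ↔ C → A ↔ C
_⟫_ = ↔-trans

T-∧⁻ : ∀ {a b} → T (a ∧ b) → T a × T b
T-∧⁻ = Equivalence.to T-∧

T-∧⁺ : ∀ {a b} → T a → T b → T (a ∧ b)
T-∧⁺ p q = Equivalence.from T-∧ (p , q)

T-∨⁻ : ∀ {a b} → T (a ∨ b) → T a ⊎ T b
T-∨⁻ = Equivalence.to T-∨

T-∨⁺ˡ : ∀ {a b} → T a → T (a ∨ b)
T-∨⁺ˡ p = Equivalence.from T-∨ (inj₁ p)

T-∨⁺ʳ : ∀ {a b} → T b → T (a ∨ b)
T-∨⁺ʳ p = Equivalence.from T-∨ (inj₂ p)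

true⇒T : ∀ {a} → a ≡ true → T a
true⇒T refl = tt

T-not-∧ : ∀ {a b} → T a → T b → ¬ T (not (a ∧ b))
T-not-∧ {true} {true} _ _ ()

T-not-∧ˡ : ∀ {a b} → T (not a) → T (not (a ∧ b))
T-not-∧ˡ {false} _ = tt

T-not-∧ʳ : ∀ {a b} → T (not b) → T (not (a ∧ b))
T-not-∧ʳ {true}  p = p
T-not-∧ʳ {false} _ = tt

≢⇒T-not-≡ᵇ : ∀ {x y} → x ≢ y → T (not (x ≡ᵇ y))
≢⇒T-not-≡ᵇ {x} {y} x≢y with x ≡ᵇ y in eq
... | true  = ⊥-elim (x≢y (≡ᵇ⇒≡ x y (true⇒T eq)))
... | false = tt

Σ-↔-irrelevant : {X : Set} {A B : X → Set} →
  (∀ {x} (a a′ : A x) → a ≡ a′) → (∀ {x} (b b′ : B x) → b ≡ b′) →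
  (∀ {x} → A x → B x) → (∀ {x} → B x → A x) → Σ X A ↔ Σ X B
Σ-↔-irrelevant A-irr B-irr to from = mk↔ₛ′
  (λ (x , a) → x , to a) (λ (x , b) → x , from b)
  (λ (x , b) → cong (x ,_) (B-irr _ _)) (λ (x , a) → cong (x ,_) (A-irr _ _))

-- Structurally recursive versions of the parity and divisibility tests of Defs,
-- so that they compute on open terms such as c + 6 * a.
oddᵇ : ℕ → Bool
oddᵇ zero          = false
oddᵇ (suc zero)    = true
oddᵇ (suc (suc n)) = oddᵇ n

mult3ᵇ : ℕ → Bool
mult3ᵇ zero                = true
mult3ᵇ (suc zero)          = false
mult3ᵇ (suc (suc zero))    = false
mult3ᵇ (suc (suc (suc n))) = mult3ᵇ n

isOdd≡oddᵇ : ∀ k → isOdd k ≡ oddᵇ k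
isOdd≡oddᵇ zero          = refl
isOdd≡oddᵇ (suc zero)    = refl
isOdd≡oddᵇ (suc (suc k)) = trans (cong (λ r → not (r ≡ᵇ 0)) (%-periodic k)) (isOdd≡oddᵇ k)
  where
  %-periodic : ∀ k → (2 + k) % 2 ≡ k % 2
  %-periodic k = trans (cong (_% 2) (+-comm 2 k)) ([m+n]%n≡m%n k 2)

isEven≡not-oddᵇ : ∀ k → isEven k ≡ not (oddᵇ k)
isEven≡not-oddᵇ k = trans (sym (not-involutive (isEven k))) (cong not (isOdd≡oddᵇ k))

div3≡mult3ᵇ : ∀ k → div3 k ≡ mult3ᵇ k
div3≡mult3ᵇ zero                = refl
div3≡mult3ᵇ (suc zero)          = refl
div3≡mult3ᵇ (suc (suc zero))    = refl
div3≡mult3ᵇ (suc (suc (suc k))) = trans (cong (_≡ᵇ 0) (%-periodic k)) (div3≡mult3ᵇ k)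
  where
  %-periodic : ∀ k → (3 + k) % 3 ≡ k % 3
  %-periodic k = trans (cong (_% 3) (+-comm 3 k)) ([m+n]%n≡m%n k 3)

weight : ℕ → ℕ
weight x = if oddᵇ x then 1 else 2

-- the least part allowed after x in a Schur partition
schurNext : ℕ → ℕ
schurNext x = if mult3ᵇ x then 4 + x else 3 + x

weight-pos : ∀ x → 1 ≤ weight x
weight-pos x with oddᵇ x
... | true  = s≤s z≤n
... | false = s≤s z≤n

≤-schurNext : ∀ x → x ≤ schurNext x
≤-schurNext x with mult3ᵇ x
... | true  = m≤n+m x 4
... | false = m≤n+m x 3

-- Families of lists with prescribed weight and twisted size

weightSum : (ℕ → ℕ) → List ℕ → ℕ
weightSum f []       = 0
weightSum f (x ∷ xs) = f x + weightSum f xs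

shiftedSum : (ℕ → ℕ) → ℕ → List ℕ → ℕ
shiftedSum f α []       = 0
shiftedSum f α (x ∷ xs) = (α * f x + x) + shiftedSum f α xs

shiftedSum-split : ∀ f α π → shiftedSum f α π ≡ α * weightSum f π + shiftedSum f 0 π
shiftedSum-split f α []       = sym (trans (+-identityʳ (α * 0)) (*-zeroʳ α))
shiftedSum-split f α (x ∷ xs) = begin
  (α * f x + x) + shiftedSum f α xs
    ≡⟨ cong ((α * f x + x) +_) (shiftedSum-split f α xs) ⟩
  (α * f x + x) + (α * weightSum f xs + shiftedSum f 0 xs)
    ≡⟨ regroup α (f x) x (weightSum f xs) (shiftedSum f 0 xs) ⟩
  α * (f x + weightSum f xs) + (x + shiftedSum f 0 xs) ∎
  where
  open ≡-Reasoning
  regroup : ∀ a b c d e → (a * b + c) + (a * d + e) ≡ a * (b + d) + (c + e)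
  regroup = solve-∀

shiftedSum-zero : ∀ f π → shiftedSum f 0 π ≡ sum π
shiftedSum-zero f []       = refl
shiftedSum-zero f (x ∷ xs) = cong (x +_) (shiftedSum-zero f xs)

-- Family P f α dm dn m n is the set of lists π satisfying P whose f-weight is
-- m − dm and whose size, each part x counted as x + α·f(x), is n − dn.  The
-- offsets dm, dn record the parts already split off, avoiding truncated subtraction.
record Fibre (P : List ℕ → Bool) (f : ℕ → ℕ) (α dm dn m n : ℕ) (π : List ℕ) : Set where
  constructor fibre
  field
    valid   : T (P π)
    weight≡ : dm + weightSum f π ≡ m
    size≡   : dn + shiftedSum f α π ≡ n

Family : (List ℕ → Bool) → (ℕ → ℕ) → (α dm dn m n : ℕ) → Set
Family P f α dm dn m n = Σ (List ℕ) (Fibre P f α dm dn m n)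

module _ {P : List ℕ → Bool} {f : ℕ → ℕ} {α dm dn m n : ℕ} where

  Fibre-irrelevant : ∀ {π} (a b : Fibre P f α dm dn m n π) → a ≡ b
  Fibre-irrelevant (fibre p e₁ e₂) (fibre q e₁′ e₂′)
    rewrite T-irrelevant p q | ≡-irrelevant e₁ e₁′ | ≡-irrelevant e₂ e₂′ = refl

  Family-≡ : ∀ {π π′} {a b} → π ≡ π′ → _≡_ {A = Family P f α dm dn m n} (π , a) (π′ , b)
  Family-≡ refl = cong (_ ,_) (Fibre-irrelevant _ _)

  Family-cast : ∀ {dm′ dn′} → dm ≡ dm′ → dn ≡ dn′ →
                Family P f α dm dn m n ↔ Family P f α dm′ dn′ m n
  Family-cast refl refl = ↔-refl

Offset : (α dm dn m n : ℕ) → ℕ × ℕ → Set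
Offset α dm dn m n (m′ , n′) = (dm + m′ ≡ m) × (dn + (α * m′ + n′) ≡ n)

Fibres : (List ℕ → Bool) → (ℕ → ℕ) → (α dm dn m n : ℕ) → Set
Fibres P f α dm dn m n =
  Σ (ℕ × ℕ) (λ i → Offset α dm dn m n i × Family P f 0 0 0 (proj₁ i) (proj₂ i))

Family↔Fibres : ∀ P f α dm dn m n → Family P f α dm dn m n ↔ Fibres P f α dm dn m n
Family↔Fibres P f α dm dn m n = mk↔ₛ′ to from to∘from from∘to
  where
  to : Family P f α dm dn m n → Fibres P f α dm dn m n
  to (π , fibre p e₁ e₂) =
    (weightSum f π , shiftedSum f 0 π) ,
    (e₁ , trans (cong (dn +_) (sym (shiftedSum-split f α π))) e₂) ,
    (π , fibre p refl refl)
  from : Fibres P f α dm dn m n → Family P f α dm dn m n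
  from ((m′ , n′) , (o₁ , o₂) , (π , fibre p e₁ e₂)) = π , fibre p
    (trans (cong (dm +_) e₁) o₁)
    (trans (cong (dn +_) (trans (shiftedSum-split f α π) (cong₂ (λ a b → α * a + b) e₁ e₂))) o₂)
  to∘from : ∀ b → to (from b) ≡ b
  to∘from (_ , _ , (π , fibre p refl refl)) =
    cong₂ (λ u v → _ , (u , v) , (π , fibre p refl refl)) (≡-irrelevant _ _) (≡-irrelevant _ _)
  from∘to : ∀ a → from (to a) ≡ a
  from∘to (π , _) = Family-≡ refl

twist-cong : ∀ {P Q f g α dm dn m n} →
  (∀ m′ n′ → Offset α dm dn m n (m′ , n′) → Family P f 0 0 0 m′ n′ ↔ Family Q g 0 0 0 m′ n′) →
  Family P f α dm dn m n ↔ Family Q g α dm dn m n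
twist-cong {P} {Q} {f} {g} {α} {dm} {dn} {m} {n} h =
  Family↔Fibres P f α dm dn m n
  ⟫ Σ-↔ ↔-refl (λ {i} → Σ-↔ ↔-refl (λ {o} → h (proj₁ i) (proj₂ i) o))
  ⟫ ↔-sym (Family↔Fibres Q g α dm dn m n)

module _ {P : List ℕ → Bool} {f : ℕ → ℕ} where

  Family-weight-zero : ∀ {α n} → (∀ x → 1 ≤ f x) → T (P []) →
                       Family P f α 0 0 0 n ↔ (0 ≡ n)
  Family-weight-zero {α} {n} f-pos p[] =
    mk↔ₛ′ to from (λ _ → ≡-irrelevant _ _) from∘to
    where
    weightless : ∀ x xs → ¬ (f x + weightSum f xs ≡ 0)
    weightless x xs e = <⇒≢ (≤-trans (f-pos x) (m≤m+n (f x) _)) (sym e)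
    from : 0 ≡ n → Family P f α 0 0 0 n
    from e = [] , fibre p[] refl e
    to : Family P f α 0 0 0 n → 0 ≡ n
    to ([]     , fibre _ _ e) = e
    to (x ∷ xs , fibre _ w _) = ⊥-elim (weightless x xs w)
    from∘to : ∀ a → from (to a) ≡ a
    from∘to ([]     , _)            = Family-≡ refl
    from∘to (x ∷ xs , fibre _ w _) = ⊥-elim (weightless x xs w)

  Family-untwist : ∀ {α m n} → α * m ≤ n →
                   Family P f α 0 0 m n ↔ Family P f 0 0 0 m (n ∸ α * m)
  Family-untwist {α} {m} {n} αm≤n = Σ-↔-irrelevant Fibre-irrelevant Fibre-irrelevant to from
    where
    to : ∀ {π} → Fibre P f α 0 0 m n π → Fibre P f 0 0 0 m (n ∸ α * m) π
    to {π} (fibre p refl e) = fibre p refl (begin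
      shiftedSum f 0 π                             ≡⟨ m+n∸m≡n (α * m) _ ⟨
      α * m + shiftedSum f 0 π ∸ α * m             ≡⟨ cong (_∸ α * m) (shiftedSum-split f α π) ⟨
      shiftedSum f α π ∸ α * m                     ≡⟨ cong (_∸ α * m) e ⟩
      n ∸ α * m                                    ∎)
      where open ≡-Reasoning
    from : ∀ {π} → Fibre P f 0 0 0 m (n ∸ α * m) π → Fibre P f α 0 0 m n π
    from {π} (fibre p refl e) = fibre p refl (begin
      shiftedSum f α π                             ≡⟨ shiftedSum-split f α π ⟩
      α * m + shiftedSum f 0 π                     ≡⟨ cong (α * m +_) e ⟩
      α * m + (n ∸ α * m)                          ≡⟨ m+[n∸m]≡n αm≤n ⟩
      n                                            ∎)
      where open ≡-Reasoning

  Family-twisted-empty : ∀ {α m n} → n < α * m → Family P f α 0 0 m n ↔ ⊥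
  Family-twisted-empty {α} {m} {n} n<αm = mk↔ₛ′ absurd (λ ()) (λ ()) (λ a → ⊥-elim (absurd a))
    where
    absurd : Family P f α 0 0 m n → ⊥
    absurd (π , fibre _ refl e) = <⇒≱ n<αm (begin
      α * m                      ≤⟨ m≤m+n (α * m) _ ⟩
      α * m + shiftedSum f 0 π   ≡⟨ shiftedSum-split f α π ⟨
      shiftedSum f α π           ≡⟨ e ⟩
      n                          ∎)
      where open ≤-Reasoning

-- Schur chains

schurFrom : ℕ → List ℕ → Bool
schurFrom j []       = true
schurFrom j (x ∷ xs) = (j ≤ᵇ x) ∧ schurFrom (schurNext x) xs

SchurFam : (j α dm dn m n : ℕ) → Set
SchurFam j = Family (schurFrom j) weight

schurFrom-mono : ∀ {i j} π → i ≤ j → T (schurFrom j π) → T (schurFrom i π)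
schurFrom-mono []       i≤j _ = tt
schurFrom-mono (x ∷ xs) i≤j p with T-∧⁻ p
... | j≤x , q = T-∧⁺ (≤⇒≤ᵇ (≤-trans i≤j (≤ᵇ⇒≤ _ x j≤x))) q

SchurFam-split : ∀ j α dm dn m n →
  SchurFam j α dm dn m n ↔
  (SchurFam (suc j) α dm dn m n ⊎
   SchurFam (schurNext j) α (dm + weight j) (dn + (α * weight j + j)) m n)
SchurFam-split j α dm dn m n = mk↔ₛ′ to from to∘from from∘to
  where
  Split : Set
  Split = SchurFam (suc j) α dm dn m n ⊎
          SchurFam (schurNext j) α (dm + weight j) (dn + (α * weight j + j)) m n
  to : SchurFam j α dm dn m n → Split
  to ([] , fibre _ e₁ e₂) = inj₁ ([] , fibre tt e₁ e₂)
  to (x ∷ xs , fibre p e₁ e₂) with x ≟ j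
  ... | yes refl =
    inj₂ (xs , fibre (proj₂ (T-∧⁻ p)) (trans (+-assoc dm _ _) e₁) (trans (+-assoc dn _ _) e₂))
  ... | no x≢j   =
    inj₁ (x ∷ xs , fibre (T-∧⁺ (≤⇒≤ᵇ j<x) (proj₂ (T-∧⁻ p))) e₁ e₂)
    where j<x = ≤∧≢⇒< (≤ᵇ⇒≤ j x (proj₁ (T-∧⁻ p))) (λ j≡x → x≢j (sym j≡x))
  from : Split → SchurFam j α dm dn m n
  from (inj₁ (π , fibre p e₁ e₂)) = π , fibre (schurFrom-mono π (n≤1+n j) p) e₁ e₂
  from (inj₂ (π , fibre p e₁ e₂)) = j ∷ π , fibre (T-∧⁺ (≤⇒≤ᵇ (≤-refl {j})) p)
    (trans (sym (+-assoc dm _ _)) e₁) (trans (sym (+-assoc dn _ _)) e₂)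
  to∘from : ∀ b → to (from b) ≡ b
  to∘from (inj₁ ([] , _)) = refl
  to∘from (inj₁ (x ∷ xs , fibre p _ _)) with x ≟ j
  ... | yes refl = ⊥-elim (1+n≰n (≤ᵇ⇒≤ (suc x) x (proj₁ (T-∧⁻ p))))
  ... | no _     = cong inj₁ (Family-≡ refl)
  to∘from (inj₂ _) with j ≟ j
  ... | yes refl = cong inj₂ (Family-≡ refl)
  ... | no j≢j   = ⊥-elim (j≢j refl)
  from∘to : ∀ a → from (to a) ≡ a
  from∘to ([] , _) = Family-≡ refl
  from∘to (x ∷ xs , _) with x ≟ j
  ... | yes refl = Family-≡ refl
  ... | no _     = Family-≡ refl

SchurFam-small : ∀ {j α dm dn m n} → n < dn + j → SchurFam j α dm dn m n ↔ (dm ≡ m × dn ≡ n)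
SchurFam-small {j} {α} {dm} {dn} {m} {n} n<dn+j = mk↔ₛ′ to from
  (λ _ → cong₂ _,_ (≡-irrelevant _ _) (≡-irrelevant _ _)) from∘to
  where
  nonempty-too-big : ∀ {x xs} → ¬ Fibre (schurFrom j) weight α dm dn m n (x ∷ xs)
  nonempty-too-big {x} {xs} (fibre p _ e) = <⇒≱ n<dn+j (begin
    dn + j                               ≤⟨ +-monoʳ-≤ dn (≤ᵇ⇒≤ j x (proj₁ (T-∧⁻ p))) ⟩
    dn + x                               ≤⟨ +-monoʳ-≤ dn (m≤n+m x (α * weight x)) ⟩
    dn + (α * weight x + x)              ≤⟨ +-monoʳ-≤ dn (m≤m+n _ (shiftedSum weight α xs)) ⟩
    dn + shiftedSum weight α (x ∷ xs)    ≡⟨ e ⟩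
    n                                    ∎)
    where open ≤-Reasoning
  to : SchurFam j α dm dn m n → dm ≡ m × dn ≡ n
  to ([]    , fibre _ e₁ e₂) = trans (sym (+-identityʳ dm)) e₁ , trans (sym (+-identityʳ dn)) e₂
  to (_ ∷ _ , a)             = ⊥-elim (nonempty-too-big a)
  from : dm ≡ m × dn ≡ n → SchurFam j α dm dn m n
  from (e₁ , e₂) = [] , fibre tt (trans (+-identityʳ dm) e₁) (trans (+-identityʳ dn) e₂)
  from∘to : ∀ a → from (to a) ≡ a
  from∘to ([]    , _) = Family-≡ refl
  from∘to (_ ∷ _ , a) = ⊥-elim (nonempty-too-big a)

-- 6 * a, unfolded so that oddᵇ and mult3ᵇ compute through it
sixfold : ℕ → ℕ
sixfold zero    = 0
sixfold (suc a) = 6 + sixfold a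

module _ (c : ℕ) where

  private
    +-sixfold-suc : ∀ a → c + sixfold (suc a) ≡ 6 + (c + sixfold a)
    +-sixfold-suc a = x∙yz≈y∙xz c 6 (sixfold a)

    oddᵇ-periodic : ∀ a → oddᵇ (c + sixfold a) ≡ oddᵇ c
    oddᵇ-periodic zero    = cong oddᵇ (+-identityʳ c)
    oddᵇ-periodic (suc a) = trans (cong oddᵇ (+-sixfold-suc a)) (oddᵇ-periodic a)

    mult3ᵇ-periodic : ∀ a → mult3ᵇ (c + sixfold a) ≡ mult3ᵇ c
    mult3ᵇ-periodic zero    = cong mult3ᵇ (+-identityʳ c)
    mult3ᵇ-periodic (suc a) = trans (cong mult3ᵇ (+-sixfold-suc a)) (mult3ᵇ-periodic a)

  weight-periodic : ∀ a → weight (c + sixfold a) ≡ weight c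
  weight-periodic a = cong (λ b → if b then 1 else 2) (oddᵇ-periodic a)

  schurNext-periodic : ∀ a → schurNext (c + sixfold a) ≡ schurNext c + sixfold a
  schurNext-periodic a rewrite mult3ᵇ-periodic a with mult3ᵇ c
  ... | true  = refl
  ... | false = refl

SchurFam-split-periodic : ∀ c a α dm dn m n →
  SchurFam (c + sixfold a) α dm dn m n ↔
  (SchurFam (suc c + sixfold a) α dm dn m n ⊎
   SchurFam (schurNext c + sixfold a) α (dm + weight c) (dn + (α * weight c + (c + sixfold a))) m n)
SchurFam-split-periodic c a α dm dn m n
  rewrite sym (schurNext-periodic c a) | sym (weight-periodic c a) =
  SchurFam-split (c + sixfold a) α dm dn m n

-- The shift theorem

-- the bound on n drives the induction: splitting off a part increases dn + j
ShiftBelow : ℕ → ℕ → Set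
ShiftBelow t j = ∀ dm dn m n → n < dn + j + t →
                 SchurFam j 2 dm dn m n ↔ SchurFam (3 + j) 0 dm dn m n

ShiftAll : ℕ → Set
ShiftAll t = ∀ a → ShiftBelow t (2 + sixfold a) × ShiftBelow t (4 + sixfold a) × ShiftBelow t (6 + sixfold a)

ShiftAll-zero : ShiftAll 0
ShiftAll-zero a = small , small , small
  where
  small : ∀ {j} → ShiftBelow 0 j
  small {j} dm dn m n n<dn+j+0 =
    SchurFam-small n<dn+j ⟫ ↔-sym (SchurFam-small (<-≤-trans n<dn+j (+-monoʳ-≤ dn (m≤n+m j 3))))
    where n<dn+j = subst (n <_) (+-identityʳ (dn + j)) n<dn+j+0

+-suc-swap : ∀ d a b → d + suc a + b ≡ d + a + suc b
+-suc-swap d a b = trans (cong (_+ b) (+-suc d a)) (sym (+-suc (d + a) b))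

module ShiftStep (t : ℕ) (ih : ShiftAll t) (c a dn m n : ℕ)
                 (bound : n < dn + (c + sixfold a) + suc t) where

  y : ℕ
  y = sixfold a

  L R : ℕ → ℕ → ℕ → Set
  L k dm′ dn′ = SchurFam (k + y) 2 dm′ dn′ m n
  R k dm′ dn′ = SchurFam (k + y) 0 dm′ dn′ m n

  ih₂ : ∀ a′ → ShiftBelow t (2 + sixfold a′)
  ih₂ a′ = proj₁ (ih a′)

  ih₄ : ∀ a′ → ShiftBelow t (4 + sixfold a′)
  ih₄ a′ = proj₁ (proj₂ (ih a′))

  ih₆ : ∀ a′ → ShiftBelow t (6 + sixfold a′)
  ih₆ a′ = proj₂ (proj₂ (ih a′))

  below : ∀ c′ {dn′} → dn ≤ dn′ → T (c <ᵇ c′) → n < dn′ + (c′ + y) + t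
  below c′ {dn′} dn≤dn′ c<c′ = ≤-<-trans n≤ (+-monoˡ-< t (+-mono-≤-< dn≤dn′ (+-monoˡ-< y (<ᵇ⇒< c c′ c<c′))))
    where n≤ = s≤s⁻¹ (subst (n <_) (+-suc (dn + (c + y)) t) bound)

shift-6 : ∀ t → ShiftAll t → ∀ a → ShiftBelow (suc t) (6 + sixfold a)
shift-6 t ih a dm dn m n bound = begin
  L 6 dm dn
    ↔⟨ SchurFam-split-periodic 6 a 2 dm dn m n ⟩
  (L 7 dm dn ⊎ L 10 (dm + 2) (dn + (10 + y)))
    ↔⟨ SchurFam-split-periodic 7 a 2 dm dn m n ⊎-cong ↔-refl ⟩
  ((L 8 dm dn ⊎ L 10 (dm + 1) (dn + (9 + y))) ⊎ L 10 (dm + 2) (dn + (10 + y)))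
    ↔⟨ (ih₂ (suc a) dm dn m n (below 8 ≤-refl tt)
         ⊎-cong ih₄ (suc a) (dm + 1) (dn + (9 + y)) m n (below 10 (m≤m+n dn _) tt))
       ⊎-cong ih₄ (suc a) (dm + 2) (dn + (10 + y)) m n (below 10 (m≤m+n dn _) tt) ⟩
  ((R 11 dm dn ⊎ R 13 (dm + 1) (dn + (9 + y))) ⊎ R 13 (dm + 2) (dn + (10 + y)))
    ↔⟨ ⊎-Props.xy∙z≈xz∙y _ _ _ ⟩
  ((R 11 dm dn ⊎ R 13 (dm + 2) (dn + (10 + y))) ⊎ R 13 (dm + 1) (dn + (9 + y)))
    ↔⟨ SchurFam-split-periodic 10 a 0 dm dn m n ⊎-cong ↔-refl ⟨
  (R 10 dm dn ⊎ R 13 (dm + 1) (dn + (9 + y)))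
    ↔⟨ SchurFam-split-periodic 9 a 0 dm dn m n ⟨
  R 9 dm dn ∎
  where
  open ShiftStep t ih 6 a dn m n bound
  open EquationalReasoning {k = bijection}

shift-4 : ∀ t → ShiftAll t → ∀ a → ShiftBelow (suc t) (4 + sixfold a)
shift-4 t ih a dm dn m n bound = begin
  L 4 dm dn
    ↔⟨ SchurFam-split-periodic 4 a 2 dm dn m n ⟩
  (L 5 dm dn ⊎ L 7 (dm + 2) (dn + (8 + y)))
    ↔⟨ SchurFam-split-periodic 5 a 2 dm dn m n
       ⊎-cong SchurFam-split-periodic 7 a 2 (dm + 2) (dn + (8 + y)) m n ⟩
  ((L 6 dm dn ⊎ L 8 (dm + 1) (dn + (7 + y))) ⊎
   (L 8 (dm + 2) (dn + (8 + y)) ⊎ L 10 (dm + 2 + 1) (dn + (8 + y) + (9 + y))))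
    ↔⟨ (ih₆ a dm dn m n (below 6 ≤-refl tt)
        ⊎-cong ih₂ (suc a) (dm + 1) (dn + (7 + y)) m n (below 8 (m≤m+n dn _) tt))
       ⊎-cong (ih₂ (suc a) (dm + 2) (dn + (8 + y)) m n (below 8 (m≤m+n dn _) tt)
        ⊎-cong ih₄ (suc a) (dm + 2 + 1) (dn + (8 + y) + (9 + y)) m n
                 (below 10 (≤-trans (m≤m+n dn _) (m≤m+n _ _)) tt)) ⟩
  ((R 9 dm dn ⊎ R 11 (dm + 1) (dn + (7 + y))) ⊎
   (R 11 (dm + 2) (dn + (8 + y)) ⊎ R 13 (dm + 2 + 1) (dn + (8 + y) + (9 + y))))
    ↔⟨ ↔-refl ⊎-cong (↔-refl ⊎-cong Family-cast (+-suc-swap dm 1 1) (+-suc-swap dn (7 + y) (9 + y))) ⟩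
  ((R 9 dm dn ⊎ R 11 (dm + 1) (dn + (7 + y))) ⊎
   (R 11 (dm + 2) (dn + (8 + y)) ⊎ R 13 (dm + 1 + 2) (dn + (7 + y) + (10 + y))))
    ↔⟨ ⊎-Props.interchange _ _ _ _ ⟩
  ((R 9 dm dn ⊎ R 11 (dm + 2) (dn + (8 + y))) ⊎
   (R 11 (dm + 1) (dn + (7 + y)) ⊎ R 13 (dm + 1 + 2) (dn + (7 + y) + (10 + y))))
    ↔⟨ SchurFam-split-periodic 8 a 0 dm dn m n
       ⊎-cong SchurFam-split-periodic 10 a 0 (dm + 1) (dn + (7 + y)) m n ⟨
  (R 8 dm dn ⊎ R 10 (dm + 1) (dn + (7 + y)))
    ↔⟨ SchurFam-split-periodic 7 a 0 dm dn m n ⟨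
  R 7 dm dn ∎
  where
  open ShiftStep t ih 4 a dn m n bound
  open EquationalReasoning {k = bijection}

shift-2 : ∀ t → ShiftAll t → ∀ a → ShiftBelow (suc t) (2 + sixfold a)
shift-2 t ih a dm dn m n bound = begin
  L 2 dm dn
    ↔⟨ SchurFam-split-periodic 2 a 2 dm dn m n ⟩
  (L 3 dm dn ⊎ L 5 (dm + 2) (dn + (6 + y)))
    ↔⟨ SchurFam-split-periodic 3 a 2 dm dn m n
       ⊎-cong SchurFam-split-periodic 5 a 2 (dm + 2) (dn + (6 + y)) m n ⟩
  ((L 4 dm dn ⊎ L 7 (dm + 1) (dn + (5 + y))) ⊎
   (L 6 (dm + 2) (dn + (6 + y)) ⊎ L 8 (dm + 2 + 1) (dn + (6 + y) + (7 + y))))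
    ↔⟨ (↔-refl ⊎-cong SchurFam-split-periodic 7 a 2 (dm + 1) (dn + (5 + y)) m n) ⊎-cong ↔-refl ⟩
  ((L 4 dm dn ⊎ (L 8 (dm + 1) (dn + (5 + y)) ⊎ L 10 (dm + 1 + 1) (dn + (5 + y) + (9 + y)))) ⊎
   (L 6 (dm + 2) (dn + (6 + y)) ⊎ L 8 (dm + 2 + 1) (dn + (6 + y) + (7 + y))))
    ↔⟨ (ih₄ a dm dn m n (below 4 ≤-refl tt)
        ⊎-cong (ih₂ (suc a) (dm + 1) (dn + (5 + y)) m n (below 8 (m≤m+n dn _) tt)
        ⊎-cong ih₄ (suc a) (dm + 1 + 1) (dn + (5 + y) + (9 + y)) m n
                 (below 10 (≤-trans (m≤m+n dn _) (m≤m+n _ _)) tt)))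
       ⊎-cong (ih₆ a (dm + 2) (dn + (6 + y)) m n (below 6 (m≤m+n dn _) tt)
        ⊎-cong ih₂ (suc a) (dm + 2 + 1) (dn + (6 + y) + (7 + y)) m n
                 (below 8 (≤-trans (m≤m+n dn _) (m≤m+n _ _)) tt)) ⟩
  ((A ⊎ (B ⊎ C)) ⊎ (R 9 (dm + 2) (dn + (6 + y)) ⊎ G))
    ↔⟨ ↔-refl ⊎-cong ((SchurFam-split-periodic 9 a 0 (dm + 2) (dn + (6 + y)) m n
                       ⟫ (SchurFam-split-periodic 10 a 0 (dm + 2) (dn + (6 + y)) m n ⊎-cong ↔-refl))
                      ⊎-cong ↔-refl) ⟩
  ((A ⊎ (B ⊎ C)) ⊎ (((D ⊎ E) ⊎ F) ⊎ G))
    ↔⟨ ↔-refl ⊎-cong ((↔-refl ⊎-cong Family-cast (+-suc-swap dm 1 1) (+-suc-swap dn (5 + y) (9 + y)))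
                      ⊎-cong Family-cast (+-suc-swap dm 1 1) (+-suc-swap dn (5 + y) (7 + y))) ⟩
  ((A ⊎ (B ⊎ C)) ⊎ (((D ⊎ E) ⊎ F′) ⊎ G′))
    ↔⟨ regroup A B C D E F′ G′ ⟩
  ((A ⊎ (D ⊎ E)) ⊎ (((B ⊎ F′) ⊎ C) ⊎ G′))
    ↔⟨ (↔-refl ⊎-cong SchurFam-split-periodic 10 a 0 (dm + 2) (dn + (6 + y)) m n)
       ⊎-cong ((SchurFam-split-periodic 9 a 0 (dm + 1) (dn + (5 + y)) m n
                ⟫ (SchurFam-split-periodic 10 a 0 (dm + 1) (dn + (5 + y)) m n ⊎-cong ↔-refl))
               ⊎-cong ↔-refl) ⟨
  ((A ⊎ R 10 (dm + 2) (dn + (6 + y))) ⊎ (R 9 (dm + 1) (dn + (5 + y)) ⊎ G′))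
    ↔⟨ SchurFam-split-periodic 6 a 0 dm dn m n
       ⊎-cong SchurFam-split-periodic 8 a 0 (dm + 1) (dn + (5 + y)) m n ⟨
  (R 6 dm dn ⊎ R 8 (dm + 1) (dn + (5 + y)))
    ↔⟨ SchurFam-split-periodic 5 a 0 dm dn m n ⟨
  R 5 dm dn ∎
  where
  open ShiftStep t ih 2 a dn m n bound
  open EquationalReasoning {k = bijection}
  regroup : (A B C D E F G : Set) →
    ((A ⊎ (B ⊎ C)) ⊎ (((D ⊎ E) ⊎ F) ⊎ G)) ↔ ((A ⊎ (D ⊎ E)) ⊎ (((B ⊎ F) ⊎ C) ⊎ G))
  regroup = solve 7 (λ a b c d e f g → (a ⊕ (b ⊕ c)) ⊕ (((d ⊕ e) ⊕ f) ⊕ g)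
                                     ⊜ (a ⊕ (d ⊕ e)) ⊕ (((b ⊕ f) ⊕ c) ⊕ g)) ↔-refl
  A B C D E F F′ G G′ : Set
  A  = R 7 dm dn
  B  = R 11 (dm + 1) (dn + (5 + y))
  C  = R 13 (dm + 1 + 1) (dn + (5 + y) + (9 + y))
  D  = R 11 (dm + 2) (dn + (6 + y))
  E  = R 13 (dm + 2 + 2) (dn + (6 + y) + (10 + y))
  F  = R 13 (dm + 2 + 1) (dn + (6 + y) + (9 + y))
  F′ = R 13 (dm + 1 + 2) (dn + (5 + y) + (10 + y))
  G  = R 11 (dm + 2 + 1) (dn + (6 + y) + (7 + y))
  G′ = R 11 (dm + 1 + 2) (dn + (5 + y) + (8 + y))

shiftAll : ∀ t → ShiftAll t
shiftAll zero      = ShiftAll-zero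
shiftAll (suc t) a = shift-2 t (shiftAll t) a , shift-4 t (shiftAll t) a , shift-6 t (shiftAll t) a

SchurFam-shift : ∀ a dm dn m n →
  (SchurFam (2 + sixfold a) 2 dm dn m n ↔ SchurFam (5 + sixfold a) 0 dm dn m n) ×
  (SchurFam (4 + sixfold a) 2 dm dn m n ↔ SchurFam (7 + sixfold a) 0 dm dn m n) ×
  (SchurFam (6 + sixfold a) 2 dm dn m n ↔ SchurFam (9 + sixfold a) 0 dm dn m n)
SchurFam-shift a dm dn m n =
  proj₁ (shiftAll (suc n) a) dm dn m n (n<+suc n) ,
  proj₁ (proj₂ (shiftAll (suc n) a)) dm dn m n (n<+suc n) ,
  proj₂ (proj₂ (shiftAll (suc n) a)) dm dn m n (n<+suc n)
  where
  n<+suc : ∀ {k} n → n < k + suc n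
  n<+suc {k} n = subst (n <_) (sym (+-suc k n)) (s≤s (m≤n+m n k))

StarFam : (dm dn m n : ℕ) → Set
StarFam dm dn m n = SchurFam 5 0 dm dn m n ⊎ SchurFam 7 0 (dm + 1) (dn + 3) m n

SchurFam-1-twisted : ∀ dm dn m n → SchurFam 1 2 dm dn m n ↔ StarFam dm dn m n
SchurFam-1-twisted dm dn m n =
  SchurFam-split 1 2 dm dn m n
  ⟫ (proj₁ (SchurFam-shift 0 dm dn m n) ⊎-cong proj₁ (proj₂ (SchurFam-shift 0 (dm + 1) (dn + 3) m n)))

SchurFam-1-split : ∀ m n → SchurFam 1 0 0 0 m n ↔ (StarFam 0 0 m n ⊎ (StarFam 1 1 m n ⊎ StarFam 2 2 m n))
SchurFam-1-split m n =
  SchurFam-split 1 0 0 0 m n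
  ⟫ (SchurFam-split 2 0 0 0 m n ⊎-cong SchurFam-split 4 0 1 1 m n)
  ⟫ ((SchurFam-split 3 0 0 0 m n ⊎-cong ↔-refl) ⊎-cong ↔-refl)
  ⟫ (((SchurFam-split 4 0 0 0 m n ⊎-cong ↔-refl) ⊎-cong ↔-refl) ⊎-cong ↔-refl)
  ⟫ regroup _ _ _ _ _ _
  where
  regroup : (A B C D E F : Set) → ((((A ⊎ B) ⊎ C) ⊎ D) ⊎ (E ⊎ F)) ↔ ((A ⊎ C) ⊎ ((E ⊎ B) ⊎ (D ⊎ F)))
  regroup = solve 6 (λ a b c d e f → (((a ⊕ b) ⊕ c) ⊕ d) ⊕ (e ⊕ f) ⊜ (a ⊕ c) ⊕ ((e ⊕ b) ⊕ (d ⊕ f))) ↔-refl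

mult3ᵇ-+3 : ∀ x → mult3ᵇ (x + 3) ≡ mult3ᵇ x
mult3ᵇ-+3 x = cong mult3ᵇ (+-comm x 3)

schurStep⇒schurNext≤ : ∀ x y → T (schurStep x y) → schurNext x ≤ y
schurStep⇒schurNext≤ x y step with T-∧⁻ {(x + 3) ≤ᵇ y} step | mult3ᵇ x in 3∣x
... | x+3≤y , _        | false = subst (_≤ y) (+-comm x 3) (≤ᵇ⇒≤ _ y x+3≤y)
... | x+3≤y , not-both | true with y ≟ x + 3
...   | no y≢x+3 = subst (_≤ y) (+-comm (suc x) 3) (≤∧≢⇒< (≤ᵇ⇒≤ _ y x+3≤y) (λ e → y≢x+3 (sym e)))
...   | yes refl = ⊥-elim (T-not-∧ (≡⇒≡ᵇ y y refl) (T-∧⁺ (true⇒T div3-x) (true⇒T div3-x+3)) not-both)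
  where
  div3-x : div3 x ≡ true
  div3-x = trans (div3≡mult3ᵇ x) 3∣x
  div3-x+3 : div3 (x + 3) ≡ true
  div3-x+3 = trans (div3≡mult3ᵇ (x + 3)) (trans (mult3ᵇ-+3 x) 3∣x)

schurNext≤⇒schurStep : ∀ x y → schurNext x ≤ y → T (schurStep x y)
schurNext≤⇒schurStep x y next≤y with mult3ᵇ x in 3∣x
... | false = T-∧⁺ (≤⇒≤ᵇ (subst (_≤ y) (+-comm 3 x) next≤y))
                   (T-not-∧ʳ {y ≡ᵇ x + 3} (T-not-∧ˡ {div3 x} (subst (λ b → T (not b)) (sym (trans (div3≡mult3ᵇ x) 3∣x)) tt)))
... | true  = T-∧⁺ (≤⇒≤ᵇ (≤-trans (subst (_≤ 4 + x) (+-comm 3 x) (n≤1+n (3 + x))) next≤y))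
                   (T-not-∧ˡ (≢⇒T-not-≡ᵇ (λ y≡x+3 → <⇒≢ (subst (_≤ y) (cong suc (+-comm 3 x)) next≤y) (sym y≡x+3))))

allB-≤-mono : ∀ {a b} xs → a ≤ b → T (allB (b ≤ᵇ_) xs) → T (allB (a ≤ᵇ_) xs)
allB-≤-mono []       a≤b _ = tt
allB-≤-mono (x ∷ xs) a≤b p with T-∧⁻ p
... | b≤x , q = T-∧⁺ (≤⇒≤ᵇ (≤-trans a≤b (≤ᵇ⇒≤ _ x b≤x))) (allB-≤-mono xs a≤b q)

isPartition-uncons : ∀ x y ys → T (isPartition (x ∷ y ∷ ys)) → T (1 ≤ᵇ x) × T (x ≤ᵇ y) × T (isPartition (y ∷ ys))
isPartition-uncons x y ys p with T-∧⁻ {allB (λ k → 1 ≤ᵇ k) (x ∷ y ∷ ys)} p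
... | positive , sorted with T-∧⁻ {1 ≤ᵇ x} positive | T-∧⁻ {x ≤ᵇ y} sorted
...   | 1≤x , positive′ | x≤y , sorted′ = 1≤x , x≤y , T-∧⁺ positive′ sorted′

isPartition-tail : ∀ x xs → T (isPartition (x ∷ xs)) → T (isPartition xs)
isPartition-tail x []       _ = tt
isPartition-tail x (y ∷ ys) p = proj₂ (proj₂ (isPartition-uncons x y ys p))

isPartition-cons : ∀ x xs → 1 ≤ x → T (allB (x ≤ᵇ_) xs) → T (isPartition xs) → T (isPartition (x ∷ xs))
isPartition-cons x []       1≤x _     _ = T-∧⁺ {allB (λ k → 1 ≤ᵇ k) (x ∷ [])} (T-∧⁺ (≤⇒≤ᵇ 1≤x) tt) tt
isPartition-cons x (y ∷ ys) 1≤x bound p with T-∧⁻ {allB (λ k → 1 ≤ᵇ k) (y ∷ ys)} p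
... | positive , sorted =
  T-∧⁺ {allB (λ k → 1 ≤ᵇ k) (x ∷ y ∷ ys)} (T-∧⁺ (≤⇒≤ᵇ 1≤x) positive)
       (T-∧⁺ (proj₁ (T-∧⁻ {x ≤ᵇ y} bound)) sorted)

isPartition-sorted : ∀ x xs → T (isPartition (x ∷ xs)) → T (allB (x ≤ᵇ_) xs)
isPartition-sorted x []       _ = tt
isPartition-sorted x (y ∷ ys) p with isPartition-uncons x y ys p
... | _ , x≤y , p′ = T-∧⁺ x≤y (allB-≤-mono ys (≤ᵇ⇒≤ x y x≤y) (isPartition-sorted y ys p′))

isSchur-uncons : ∀ x y ys → T (isSchur (x ∷ y ∷ ys)) →
                 T (isPartition (x ∷ y ∷ ys)) × T (schurStep x y) × T (isSchur (y ∷ ys))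
isSchur-uncons x y ys s with T-∧⁻ {isPartition (x ∷ y ∷ ys)} s
... | partition , steps with T-∧⁻ {schurStep x y} steps
...   | step , steps′ = partition , step , T-∧⁺ (isPartition-tail x (y ∷ ys) partition) steps′

isSchur-tail : ∀ x xs → T (isSchur (x ∷ xs)) → T (isSchur xs)
isSchur-tail x []       _ = tt
isSchur-tail x (y ∷ ys) s = proj₂ (proj₂ (isSchur-uncons x y ys s))

isSchur-cons : ∀ x xs → 1 ≤ x → T (isSchur xs) → T (allB (schurNext x ≤ᵇ_) xs) → T (isSchur (x ∷ xs))
isSchur-cons x xs 1≤x s bound with T-∧⁻ {isPartition xs} s
... | partition , steps =
  T-∧⁺ (isPartition-cons x xs 1≤x (allB-≤-mono xs (≤-schurNext x) bound) partition) (steps′ xs bound steps)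
  where
  steps′ : ∀ xs → T (allB (schurNext x ≤ᵇ_) xs) → T (linkedB schurStep xs) → T (linkedB schurStep (x ∷ xs))
  steps′ []       _     _  = tt
  steps′ (y ∷ _)  bound ss =
    T-∧⁺ (schurNext≤⇒schurStep x y (≤ᵇ⇒≤ _ y (proj₁ (T-∧⁻ {schurNext x ≤ᵇ y} bound)))) ss

schurFrom⇒isSchur : ∀ L π → 1 ≤ L → T (schurFrom L π) → T (isSchur π) × T (allB (L ≤ᵇ_) π)
schurFrom⇒isSchur L []       _   _ = tt , tt
schurFrom⇒isSchur L (x ∷ xs) 1≤L p =
  isSchur-cons x xs (≤-trans 1≤L L≤x) (proj₁ rest) (proj₂ rest) ,
  T-∧⁺ (proj₁ (T-∧⁻ p)) (allB-≤-mono xs (≤-trans L≤x (≤-schurNext x)) (proj₂ rest))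
  where
  L≤x : L ≤ x
  L≤x = ≤ᵇ⇒≤ L x (proj₁ (T-∧⁻ p))
  rest : T (isSchur xs) × T (allB (schurNext x ≤ᵇ_) xs)
  rest = schurFrom⇒isSchur (schurNext x) xs (≤-trans 1≤L (≤-trans L≤x (≤-schurNext x))) (proj₂ (T-∧⁻ p))

isSchur⇒schurFrom : ∀ L π → T (isSchur π) → T (allB (L ≤ᵇ_) π) → T (schurFrom L π)
isSchur⇒schurFrom L []           _ _     = tt
isSchur⇒schurFrom L (x ∷ [])     _ bound = T-∧⁺ (proj₁ (T-∧⁻ {L ≤ᵇ x} bound)) tt
isSchur⇒schurFrom L (x ∷ y ∷ ys) s bound =
  T-∧⁺ (proj₁ (T-∧⁻ {L ≤ᵇ x} bound)) (isSchur⇒schurFrom (schurNext x) (y ∷ ys) s′ next≤rest)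
  where
  s′ = proj₂ (proj₂ (isSchur-uncons x y ys s))
  next≤rest : T (allB (schurNext x ≤ᵇ_) (y ∷ ys))
  next≤rest = allB-≤-mono (y ∷ ys) (schurStep⇒schurNext≤ x y (proj₁ (proj₂ (isSchur-uncons x y ys s))))
    (T-∧⁺ (≤⇒≤ᵇ (≤-refl {y})) (isPartition-sorted y ys (proj₁ (T-∧⁻ {isPartition (y ∷ ys)} s′))))

weight≡if-isEven : ∀ x → weight x ≡ (if isEven x then 2 else 1)
weight≡if-isEven x rewrite isEven≡not-oddᵇ x with oddᵇ x
... | true  = refl
... | false = refl

mStat≡weightSum : ∀ π → mStat π ≡ weightSum weight π
mStat≡weightSum []       = refl
mStat≡weightSum (x ∷ xs) with isEven x | weight≡if-isEven x
... | true  | w≡2 rewrite w≡2 =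
  trans (+-suc (suc (length xs)) (numEven xs)) (cong (2 +_) (mStat≡weightSum xs))
... | false | w≡1 rewrite w≡1 = cong suc (mStat≡weightSum xs)

inD⇒Fibre : ∀ {m n} π → T (inD m n π) → Fibre (schurFrom 1) weight 0 0 0 m n π
inD⇒Fibre π p with T-∧⁻ p
... | s , stats with T-∧⁻ stats
...   | sum≡ , mStat≡ =
  fibre (isSchur⇒schurFrom 1 π s (proj₁ (T-∧⁻ (proj₁ (T-∧⁻ s)))))
        (trans (sym (mStat≡weightSum π)) (≡ᵇ⇒≡ _ _ mStat≡))
        (trans (shiftedSum-zero weight π) (≡ᵇ⇒≡ _ _ sum≡))

Fibre⇒inD : ∀ {m n} π → Fibre (schurFrom 1) weight 0 0 0 m n π → T (inD m n π)
Fibre⇒inD π (fibre p e₁ e₂) =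
  T-∧⁺ (proj₁ (schurFrom⇒isSchur 1 π ≤-refl p))
       (T-∧⁺ (≡⇒≡ᵇ _ _ (trans (sym (shiftedSum-zero weight π)) e₂))
             (≡⇒≡ᵇ _ _ (trans (mStat≡weightSum π) e₁)))

𝒟↔SchurFam : ∀ m n → 𝒟 m n ↔ SchurFam 1 0 0 0 m n
𝒟↔SchurFam m n = Σ-↔-irrelevant T-irrelevant Fibre-irrelevant (inD⇒Fibre _) (Fibre⇒inD _)

starCond⇒5≤ : ∀ x → x ≢ 3 → T (starCond x) → 5 ≤ x
starCond⇒5≤ 3 x≢3 _ = ⊥-elim (x≢3 refl)
starCond⇒5≤ (suc (suc (suc (suc (suc x))))) _ _ = s≤s (s≤s (s≤s (s≤s (s≤s z≤n))))

5≤⇒starCond : ∀ x → 5 ≤ x → T (starCond x)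
5≤⇒starCond 1 (s≤s ())
5≤⇒starCond 2 (s≤s (s≤s ()))
5≤⇒starCond 3 (s≤s (s≤s (s≤s ())))
5≤⇒starCond 4 (s≤s (s≤s (s≤s (s≤s ()))))
5≤⇒starCond 5 _ = tt
5≤⇒starCond (suc (suc (suc (suc (suc (suc x)))))) _ with isEven (6 + x)
... | true  = tt
... | false = tt

schurFrom⇒allStar : ∀ L π → 5 ≤ L → T (schurFrom L π) → T (allB starCond π)
schurFrom⇒allStar L π 5≤L p = all-star π (proj₂ (schurFrom⇒isSchur L π (≤-trans (s≤s z≤n) 5≤L) p))
  where
  all-star : ∀ π → T (allB (L ≤ᵇ_) π) → T (allB starCond π)
  all-star []       _     = tt
  all-star (x ∷ xs) bound = T-∧⁺ (5≤⇒starCond x (≤-trans 5≤L (≤ᵇ⇒≤ L x (proj₁ (T-∧⁻ bound)))))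
                                 (all-star xs (proj₂ (T-∧⁻ bound)))

𝒟*↔StarFam : ∀ m n → 𝒟* m n ↔ StarFam 0 0 m n
𝒟*↔StarFam m n = mk↔ₛ′ to from to∘from from∘to
  where
  to : 𝒟* m n → StarFam 0 0 m n
  to (π , p) with inD⇒Fibre π (proj₁ (T-∧⁻ p))
  to ([]     , p) | fibre _ e₁ e₂ = inj₁ ([] , fibre tt e₁ e₂)
  to (x ∷ xs , p) | fibre q e₁ e₂ with x ≟ 3
  ... | yes refl = inj₂ (xs , fibre (proj₂ (T-∧⁻ q)) e₁ e₂)
  ... | no x≢3   = inj₁ (x ∷ xs , fibre (T-∧⁺ (≤⇒≤ᵇ 5≤x) (proj₂ (T-∧⁻ q))) e₁ e₂)
    where 5≤x = starCond⇒5≤ x x≢3 (proj₁ (T-∧⁻ {starCond x} (proj₂ (T-∧⁻ {inD m n (x ∷ xs)} p))))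
  from : StarFam 0 0 m n → 𝒟* m n
  from (inj₁ (π , fibre p e₁ e₂)) =
    π , T-∧⁺ (Fibre⇒inD π (fibre (schurFrom-mono π (s≤s z≤n) p) e₁ e₂)) (schurFrom⇒allStar 5 π ≤-refl p)
  from (inj₂ (π , fibre p e₁ e₂)) =
    3 ∷ π , T-∧⁺ (Fibre⇒inD (3 ∷ π) (fibre (T-∧⁺ tt p) e₁ e₂)) (T-∧⁺ tt (schurFrom⇒allStar 7 π (m≤n+m 5 2) p))
  to∘from : ∀ b → to (from b) ≡ b
  to∘from (inj₁ ([] , _)) = cong inj₁ (Family-≡ refl)
  to∘from (inj₁ (x ∷ xs , fibre p _ _)) with x ≟ 3
  ... | yes refl = ⊥-elim p
  ... | no _     = cong inj₁ (Family-≡ refl)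
  to∘from (inj₂ _) = cong inj₂ (Family-≡ refl)
  from∘to : ∀ a → from (to a) ≡ a
  from∘to (π , p) with inD⇒Fibre π (proj₁ (T-∧⁻ p))
  from∘to ([]     , p) | fibre _ _ _ = cong ([] ,_) (T-irrelevant _ _)
  from∘to (x ∷ xs , p) | fibre _ _ _ with x ≟ 3
  ... | yes refl = cong (3 ∷ xs ,_) (T-irrelevant _ _)
  ... | no _     = cong (x ∷ xs ,_) (T-irrelevant _ _)

-- Odd parts occurring at most twice

oddFrom : ℕ → List ℕ → Bool
oddFrom L []           = true
oddFrom L (x ∷ [])     = oddᵇ x ∧ (L ≤ᵇ x)
oddFrom L (x ∷ y ∷ ys) = oddᵇ x ∧ (L ≤ᵇ x) ∧ (((x ≡ᵇ y) ∧ oddFrom (2 + x) ys) ∨ oddFrom (2 + x) (y ∷ ys))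

OddFam : (L α dm dn m n : ℕ) → Set
OddFam L = Family (oddFrom L) (λ _ → 1)

oddFrom-odd : ∀ L x xs → T (oddFrom L (x ∷ xs)) → T (oddᵇ x)
oddFrom-odd L x []      p = proj₁ (T-∧⁻ p)
oddFrom-odd L x (_ ∷ _) p = proj₁ (T-∧⁻ p)

oddFrom-head : ∀ L x xs → T (oddFrom L (x ∷ xs)) → L ≤ x
oddFrom-head L x []      p = ≤ᵇ⇒≤ L x (proj₂ (T-∧⁻ p))
oddFrom-head L x (_ ∷ _) p = ≤ᵇ⇒≤ L x (proj₁ (T-∧⁻ {L ≤ᵇ x} (proj₂ (T-∧⁻ {oddᵇ x} p))))

oddFrom-relax : ∀ L L′ x xs → L′ ≤ x → T (oddFrom L (x ∷ xs)) → T (oddFrom L′ (x ∷ xs))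
oddFrom-relax L L′ x []      L′≤x p = T-∧⁺ (proj₁ (T-∧⁻ p)) (≤⇒≤ᵇ L′≤x)
oddFrom-relax L L′ x (_ ∷ _) L′≤x p with T-∧⁻ {oddᵇ x} p
... | odd , rest = T-∧⁺ odd (T-∧⁺ (≤⇒≤ᵇ L′≤x) (proj₂ (T-∧⁻ {L ≤ᵇ x} rest)))

oddFrom-mono : ∀ L L′ π → L′ ≤ L → T (oddFrom L π) → T (oddFrom L′ π)
oddFrom-mono L L′ []       _     _ = tt
oddFrom-mono L L′ (x ∷ xs) L′≤L p = oddFrom-relax L L′ x xs (≤-trans L′≤L (oddFrom-head L x xs p)) p

odd-≢1⇒3≤ : ∀ x → T (oddᵇ x) → x ≢ 1 → 3 ≤ x
odd-≢1⇒3≤ 1 _ x≢1 = ⊥-elim (x≢1 refl)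
odd-≢1⇒3≤ (suc (suc (suc x))) _ _ = s≤s (s≤s (s≤s z≤n))

OddFam-split-ones : ∀ dm dn m n →
  OddFam 1 0 dm dn m n ↔
  (OddFam 3 0 dm dn m n ⊎ (OddFam 3 0 (dm + 1) (dn + 1) m n ⊎ OddFam 3 0 (dm + 2) (dn + 2) m n))
OddFam-split-ones dm dn m n = mk↔ₛ′ to from to∘from from∘to
  where
  Split : Set
  Split = OddFam 3 0 dm dn m n ⊎ (OddFam 3 0 (dm + 1) (dn + 1) m n ⊎ OddFam 3 0 (dm + 2) (dn + 2) m n)

  no-1-from-3 : ∀ xs → ¬ T (oddFrom 3 (1 ∷ xs))
  no-1-from-3 xs p with oddFrom-head 3 1 xs p
  ... | s≤s ()

  two-ones : ∀ ys → T (((1 ≡ᵇ 1) ∧ oddFrom 3 ys) ∨ oddFrom 3 (1 ∷ ys)) → T (oddFrom 3 ys)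
  two-ones ys p with T-∨⁻ p
  ... | inj₁ q = proj₂ (T-∧⁻ q)
  ... | inj₂ q = ⊥-elim (no-1-from-3 ys q)

  one-one : ∀ y ys → y ≢ 1 → T (((1 ≡ᵇ y) ∧ oddFrom 3 ys) ∨ oddFrom 3 (y ∷ ys)) → T (oddFrom 3 (y ∷ ys))
  one-one y ys y≢1 p with T-∨⁻ p
  ... | inj₁ q = ⊥-elim (y≢1 (sym (≡ᵇ⇒≡ 1 y (proj₁ (T-∧⁻ q)))))
  ... | inj₂ q = q

  after-one : ∀ xs → Fibre (oddFrom 1) (λ _ → 1) 0 dm dn m n (1 ∷ xs) → Split
  after-one [] (fibre _ e₁ e₂) =
    inj₂ (inj₁ ([] , fibre tt (trans (+-assoc dm 1 0) e₁) (trans (+-assoc dn 1 0) e₂)))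
  after-one (y ∷ ys) (fibre p e₁ e₂) with y ≟ 1
  ... | yes refl = inj₂ (inj₂ (ys , fibre (two-ones ys (proj₂ (T-∧⁻ p)))
                                          (trans (+-assoc dm 2 _) e₁) (trans (+-assoc dn 2 _) e₂)))
  ... | no y≢1   = inj₂ (inj₁ (y ∷ ys , fibre (one-one y ys y≢1 (proj₂ (T-∧⁻ p)))
                                              (trans (+-assoc dm 1 _) e₁) (trans (+-assoc dn 1 _) e₂)))

  to : OddFam 1 0 dm dn m n → Split
  to ([]     , fibre _ e₁ e₂) = inj₁ ([] , fibre tt e₁ e₂)
  to (x ∷ xs , a@(fibre p e₁ e₂)) with x ≟ 1
  ... | yes refl = after-one xs a
  ... | no x≢1   = inj₁ (x ∷ xs , fibre (oddFrom-relax 1 3 x xs 3≤x p) e₁ e₂)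
    where 3≤x = odd-≢1⇒3≤ x (oddFrom-odd 1 x xs p) x≢1

  from : Split → OddFam 1 0 dm dn m n
  from (inj₁ (π , fibre p e₁ e₂)) = π , fibre (oddFrom-mono 3 1 π (s≤s z≤n) p) e₁ e₂
  from (inj₂ (inj₁ (π , fibre p e₁ e₂))) =
    1 ∷ π , fibre (one-then π p) (trans (sym (+-assoc dm 1 _)) e₁) (trans (sym (+-assoc dn 1 _)) e₂)
    where
    one-then : ∀ π → T (oddFrom 3 π) → T (oddFrom 1 (1 ∷ π))
    one-then []      _ = tt
    one-then (_ ∷ _) p = T-∨⁺ʳ p
  from (inj₂ (inj₂ (π , fibre p e₁ e₂))) =
    1 ∷ 1 ∷ π , fibre (T-∨⁺ˡ p) (trans (sym (+-assoc dm 2 _)) e₁) (trans (sym (+-assoc dn 2 _)) e₂)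

  to∘from : ∀ b → to (from b) ≡ b
  to∘from (inj₁ ([] , _)) = cong inj₁ (Family-≡ refl)
  to∘from (inj₁ (x ∷ xs , fibre p _ _)) with x ≟ 1
  ... | yes refl = ⊥-elim (no-1-from-3 xs p)
  ... | no _     = cong inj₁ (Family-≡ refl)
  to∘from (inj₂ (inj₁ ([] , _))) = cong (λ c → inj₂ (inj₁ c)) (Family-≡ refl)
  to∘from (inj₂ (inj₁ (y ∷ ys , fibre p _ _))) with y ≟ 1
  ... | yes refl = ⊥-elim (no-1-from-3 ys p)
  ... | no _     = cong (λ c → inj₂ (inj₁ c)) (Family-≡ refl)
  to∘from (inj₂ (inj₂ _)) = cong (λ c → inj₂ (inj₂ c)) (Family-≡ refl)

  from∘to : ∀ a → from (to a) ≡ a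
  from∘to ([] , _) = Family-≡ refl
  from∘to (x ∷ xs , _) with x ≟ 1
  from∘to (x ∷ xs , _)       | no _     = Family-≡ refl
  from∘to (.1 ∷ [] , _)      | yes refl = Family-≡ refl
  from∘to (.1 ∷ y ∷ ys , _)  | yes refl with y ≟ 1
  ... | yes refl = Family-≡ refl
  ... | no _     = Family-≡ refl

oddAtMostTwice : List ℕ → Bool
oddAtMostTwice π = isPartition π ∧ allB isOdd π ∧ atMostTwice π

odd⇒1≤ : ∀ x → T (oddᵇ x) → 1 ≤ x
odd⇒1≤ (suc _) _ = s≤s z≤n

odd-gap : ∀ x y → T (oddᵇ x) → T (oddᵇ y) → x ≤ y → x ≢ y → 2 + x ≤ y
odd-gap 1 1 _ _ _ x≢y = ⊥-elim (x≢y refl)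
odd-gap 1 (suc (suc (suc y))) _ _ _ _ = s≤s (s≤s (s≤s z≤n))
odd-gap (suc (suc x)) (suc (suc y)) ox oy (s≤s (s≤s x≤y)) x≢y =
  s≤s (s≤s (odd-gap x y ox oy x≤y (λ x≡y → x≢y (cong (2 +_) x≡y))))

2+≤⇒≢ : ∀ {x y} → 2 + x ≤ y → x ≢ y
2+≤⇒≢ {x} 2+x≤y = <⇒≢ (≤-trans (n≤1+n (suc x)) 2+x≤y)

atMostTwice-gap : ∀ x ys → T (allB ((2 + x) ≤ᵇ_) ys) → T (atMostTwice ys) → T (atMostTwice (x ∷ ys))
atMostTwice-gap x []           _     _  = tt
atMostTwice-gap x (_ ∷ [])     _     _  = tt
atMostTwice-gap x (y ∷ z ∷ zs) bound am =
  T-∧⁺ (T-not-∧ˡ (≢⇒T-not-≡ᵇ (2+≤⇒≢ (≤ᵇ⇒≤ _ y (proj₁ (T-∧⁻ bound)))))) am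

atMostTwice-pair : ∀ x ys → T (allB ((2 + x) ≤ᵇ_) ys) → T (atMostTwice ys) → T (atMostTwice (x ∷ x ∷ ys))
atMostTwice-pair x []       _     _  = tt
atMostTwice-pair x (z ∷ zs) bound am =
  T-∧⁺ (T-not-∧ʳ (≢⇒T-not-≡ᵇ (2+≤⇒≢ (≤ᵇ⇒≤ _ z (proj₁ (T-∧⁻ bound)))))) (atMostTwice-gap x (z ∷ zs) bound am)

oddAtMostTwice-atMostTwice : ∀ π → T (oddAtMostTwice π) → T (atMostTwice π)
oddAtMostTwice-atMostTwice π c = proj₂ (T-∧⁻ {allB isOdd π} (proj₂ (T-∧⁻ {isPartition π} c)))

oddAtMostTwice-cons : ∀ x xs → T (oddᵇ x) → T (allB (x ≤ᵇ_) xs) → T (oddAtMostTwice xs) →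
                      T (atMostTwice (x ∷ xs)) → T (oddAtMostTwice (x ∷ xs))
oddAtMostTwice-cons x xs odd bound c am with T-∧⁻ {isPartition xs} c
... | partition , rest =
  T-∧⁺ (isPartition-cons x xs (odd⇒1≤ x odd) bound partition)
       (T-∧⁺ (T-∧⁺ (subst T (sym (isOdd≡oddᵇ x)) odd) (proj₁ (T-∧⁻ {allB isOdd xs} rest))) am)

module _ (L x : ℕ) (odd : T (oddᵇ x)) (L≤x : T (L ≤ᵇ x)) where

  private
    L≤2+x : L ≤ 2 + x
    L≤2+x = ≤-trans (≤ᵇ⇒≤ L x L≤x) (m≤n+m x 2)

  oddAtMostTwice-single : ∀ ys → T (oddAtMostTwice ys) × T (allB ((2 + x) ≤ᵇ_) ys) →
                          T (oddAtMostTwice (x ∷ ys)) × T (allB (L ≤ᵇ_) (x ∷ ys))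
  oddAtMostTwice-single ys (c , bound) =
    oddAtMostTwice-cons x ys odd (allB-≤-mono ys (m≤n+m x 2) bound) c
      (atMostTwice-gap x ys bound (oddAtMostTwice-atMostTwice ys c)) ,
    T-∧⁺ L≤x (allB-≤-mono ys L≤2+x bound)

  oddAtMostTwice-double : ∀ y ys → T (x ≡ᵇ y) → T (oddAtMostTwice ys) × T (allB ((2 + x) ≤ᵇ_) ys) →
                          T (oddAtMostTwice (x ∷ y ∷ ys)) × T (allB (L ≤ᵇ_) (x ∷ y ∷ ys))
  oddAtMostTwice-double y ys x≡y (c , bound) with ≡ᵇ⇒≡ x y x≡y
  ... | refl =
    oddAtMostTwice-cons x (x ∷ ys) odd (T-∧⁺ (≤⇒≤ᵇ (≤-refl {x})) x≤ys)
      (oddAtMostTwice-cons x ys odd x≤ys c (atMostTwice-gap x ys bound am)) (atMostTwice-pair x ys bound am) ,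
    T-∧⁺ L≤x (T-∧⁺ L≤x (allB-≤-mono ys L≤2+x bound))
    where
    x≤ys = allB-≤-mono ys (m≤n+m x 2) bound
    am   = oddAtMostTwice-atMostTwice ys c

oddFrom⇒oddAtMostTwice : ∀ L π → T (oddFrom L π) → T (oddAtMostTwice π) × T (allB (L ≤ᵇ_) π)
oddFrom⇒oddAtMostTwice L []       _ = tt , tt
oddFrom⇒oddAtMostTwice L (x ∷ []) p =
  oddAtMostTwice-single L x (proj₁ (T-∧⁻ {oddᵇ x} p)) (proj₂ (T-∧⁻ {oddᵇ x} p)) [] (tt , tt)
oddFrom⇒oddAtMostTwice L (x ∷ y ∷ ys) p =
  [ (λ q → oddAtMostTwice-double L x odd L≤x y ys (proj₁ (T-∧⁻ {x ≡ᵇ y} q))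
             (oddFrom⇒oddAtMostTwice (2 + x) ys (proj₂ (T-∧⁻ {x ≡ᵇ y} q))))
  , (λ q → oddAtMostTwice-single L x odd L≤x (y ∷ ys) (oddFrom⇒oddAtMostTwice (2 + x) (y ∷ ys) q))
  ]′ (T-∨⁻ {(x ≡ᵇ y) ∧ oddFrom (2 + x) ys} choice)
  where
  odd    = proj₁ (T-∧⁻ {oddᵇ x} p)
  L≤x    = proj₁ (T-∧⁻ {L ≤ᵇ x} (proj₂ (T-∧⁻ {oddᵇ x} p)))
  choice = proj₂ (T-∧⁻ {L ≤ᵇ x} (proj₂ (T-∧⁻ {oddᵇ x} p)))

oddAtMostTwice-uncons : ∀ x xs → T (oddAtMostTwice (x ∷ xs)) →
                        T (oddᵇ x) × T (allB (x ≤ᵇ_) xs) × T (oddAtMostTwice xs)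
oddAtMostTwice-uncons x xs c with T-∧⁻ {isPartition (x ∷ xs)} c
... | partition , rest with T-∧⁻ {allB isOdd (x ∷ xs)} rest
...   | odds , am =
  subst T (isOdd≡oddᵇ x) (proj₁ (T-∧⁻ {isOdd x} odds)) ,
  isPartition-sorted x xs partition ,
  T-∧⁺ (isPartition-tail x xs partition) (T-∧⁺ (proj₂ (T-∧⁻ {isOdd x} odds)) (atMostTwice-tail xs am))
  where
  atMostTwice-tail : ∀ xs → T (atMostTwice (x ∷ xs)) → T (atMostTwice xs)
  atMostTwice-tail []           _  = tt
  atMostTwice-tail (_ ∷ [])     _  = tt
  atMostTwice-tail (y ∷ z ∷ zs) am = proj₂ (T-∧⁻ {not ((x ≡ᵇ y) ∧ (y ≡ᵇ z))} am)

oddAtMostTwice-gap-single : ∀ x y ys → x ≢ y → T (oddAtMostTwice (x ∷ y ∷ ys)) → T (allB ((2 + x) ≤ᵇ_) (y ∷ ys))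
oddAtMostTwice-gap-single x y ys x≢y c with oddAtMostTwice-uncons x (y ∷ ys) c
... | odd-x , x≤y∷ys , c′ with oddAtMostTwice-uncons y ys c′
...   | odd-y , y≤ys , _ =
  T-∧⁺ (≤⇒≤ᵇ 2+x≤y) (allB-≤-mono ys 2+x≤y y≤ys)
  where 2+x≤y = odd-gap x y odd-x odd-y (≤ᵇ⇒≤ x y (proj₁ (T-∧⁻ {x ≤ᵇ y} x≤y∷ys))) x≢y

oddAtMostTwice-gap-pair : ∀ x y ys → x ≡ y → T (oddAtMostTwice (x ∷ y ∷ ys)) → T (allB ((2 + x) ≤ᵇ_) ys)
oddAtMostTwice-gap-pair x .x []       refl _ = tt
oddAtMostTwice-gap-pair x .x (z ∷ zs) refl c =
  oddAtMostTwice-gap-single x z zs x≢z (proj₂ (proj₂ (oddAtMostTwice-uncons x (x ∷ z ∷ zs) c)))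
  where
  not-triple : T (not ((x ≡ᵇ x) ∧ (x ≡ᵇ z)))
  not-triple = proj₁ (T-∧⁻ {not ((x ≡ᵇ x) ∧ (x ≡ᵇ z))} (oddAtMostTwice-atMostTwice (x ∷ x ∷ z ∷ zs) c))
  x≢z : x ≢ z
  x≢z x≡z = T-not-∧ (≡⇒≡ᵇ x x refl) (≡⇒≡ᵇ x z x≡z) not-triple

oddAtMostTwice⇒oddFrom : ∀ L π → T (oddAtMostTwice π) → T (allB (L ≤ᵇ_) π) → T (oddFrom L π)
oddAtMostTwice⇒oddFrom L []           _ _     = tt
oddAtMostTwice⇒oddFrom L (x ∷ [])     c bound =
  T-∧⁺ (proj₁ (oddAtMostTwice-uncons x [] c)) (proj₁ (T-∧⁻ {L ≤ᵇ x} bound))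
oddAtMostTwice⇒oddFrom L (x ∷ y ∷ ys) c bound =
  T-∧⁺ (proj₁ (oddAtMostTwice-uncons x (y ∷ ys) c))
    (T-∧⁺ (proj₁ (T-∧⁻ {L ≤ᵇ x} bound))
      (choose (x ≟ y) (oddAtMostTwice⇒oddFrom (2 + x) ys) (oddAtMostTwice⇒oddFrom (2 + x) (y ∷ ys))))
  where
  c′ : T (oddAtMostTwice (y ∷ ys))
  c′ = proj₂ (proj₂ (oddAtMostTwice-uncons x (y ∷ ys) c))
  choose : Dec (x ≡ y) →
           (T (oddAtMostTwice ys) → T (allB ((2 + x) ≤ᵇ_) ys) → T (oddFrom (2 + x) ys)) →
           (T (oddAtMostTwice (y ∷ ys)) → T (allB ((2 + x) ≤ᵇ_) (y ∷ ys)) → T (oddFrom (2 + x) (y ∷ ys))) →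
           T (((x ≡ᵇ y) ∧ oddFrom (2 + x) ys) ∨ oddFrom (2 + x) (y ∷ ys))
  choose (yes x≡y) pair _ =
    T-∨⁺ˡ (T-∧⁺ (≡⇒≡ᵇ x y x≡y) (pair (proj₂ (proj₂ (oddAtMostTwice-uncons y ys c′)))
                                     (oddAtMostTwice-gap-pair x y ys x≡y c)))
  choose (no x≢y) _ single = T-∨⁺ʳ (single c′ (oddAtMostTwice-gap-single x y ys x≢y c))

length≡weightSum : ∀ π → length π ≡ weightSum (λ _ → 1) π
length≡weightSum []       = refl
length≡weightSum (_ ∷ xs) = cong suc (length≡weightSum xs)

odd-2≤⇒3≤ : ∀ π → T (allB isOdd π) → T (allB (2 ≤ᵇ_) π) → T (allB (3 ≤ᵇ_) π)
odd-2≤⇒3≤ []       _    _     = tt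
odd-2≤⇒3≤ (x ∷ xs) odds bound =
  T-∧⁺ (≤⇒≤ᵇ (odd-≢1⇒3≤ x (subst T (isOdd≡oddᵇ x) (proj₁ (T-∧⁻ {isOdd x} odds))) x≢1))
       (odd-2≤⇒3≤ xs (proj₂ (T-∧⁻ {isOdd x} odds)) (proj₂ (T-∧⁻ {2 ≤ᵇ x} bound)))
  where
  x≢1 : x ≢ 1
  x≢1 refl = bound

𝒞*↔OddFam : ∀ m n → 𝒞* m n ↔ OddFam 3 0 0 0 m n
𝒞*↔OddFam m n = Σ-↔-irrelevant T-irrelevant Fibre-irrelevant (to _) (from _)
  where
  to : ∀ π → T (inCStar m n π) → Fibre (oddFrom 3) (λ _ → 1) 0 0 0 m n π
  to π p with T-∧⁻ {inC m n π} p
  ... | c , above-1 with T-∧⁻ {isPartition π} c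
  ...   | partition , c₁ with T-∧⁻ {allB isOdd π} c₁
  ...     | odds , c₂ with T-∧⁻ {atMostTwice π} c₂
  ...       | am , c₃ with T-∧⁻ {sum π ≡ᵇ n} c₃
  ...         | sum≡ , length≡ =
    fibre (oddAtMostTwice⇒oddFrom 3 π (T-∧⁺ partition (T-∧⁺ odds am)) (odd-2≤⇒3≤ π odds above-1))
          (trans (sym (length≡weightSum π)) (≡ᵇ⇒≡ _ _ length≡))
          (trans (shiftedSum-zero (λ _ → 1) π) (≡ᵇ⇒≡ _ _ sum≡))
  from : ∀ π → Fibre (oddFrom 3) (λ _ → 1) 0 0 0 m n π → T (inCStar m n π)
  from π (fibre p e₁ e₂) with oddFrom⇒oddAtMostTwice 3 π p
  ... | c , 3≤π with T-∧⁻ {isPartition π} c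
  ...   | partition , c₁ with T-∧⁻ {allB isOdd π} c₁
  ...     | odds , am =
    T-∧⁺ (T-∧⁺ partition (T-∧⁺ odds (T-∧⁺ am
           (T-∧⁺ (≡⇒≡ᵇ _ _ (trans (sym (shiftedSum-zero (λ _ → 1) π)) e₂))
                 (≡⇒≡ᵇ _ _ (trans (length≡weightSum π) e₁))))))
         (allB-≤-mono π (s≤s (s≤s z≤n)) 3≤π)

≤ᵇ-+2 : ∀ a b → (2 + a ≤ᵇ 2 + b) ≡ (a ≤ᵇ b)
≤ᵇ-+2 zero    b = refl
≤ᵇ-+2 (suc a) b = refl

oddFrom-+2 : ∀ L σ → oddFrom (2 + L) (map (2 +_) σ) ≡ oddFrom L σ
oddFrom-+2 L []           = refl
oddFrom-+2 L (x ∷ [])     = cong (oddᵇ x ∧_) (≤ᵇ-+2 L x)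
oddFrom-+2 L (x ∷ y ∷ ys) = cong₂ (λ a c → oddᵇ x ∧ (a ∧ c)) (≤ᵇ-+2 L x)
  (cong₂ (λ c d → ((x ≡ᵇ y) ∧ c) ∨ d) (oddFrom-+2 (2 + x) ys) (oddFrom-+2 (2 + x) (y ∷ ys)))

map-+2-∸2 : ∀ ρ → T (allB (2 ≤ᵇ_) ρ) → map (2 +_) (map (_∸ 2) ρ) ≡ ρ
map-+2-∸2 []       _     = refl
map-+2-∸2 (x ∷ xs) bound =
  cong₂ _∷_ (m+[n∸m]≡n (≤ᵇ⇒≤ 2 x (proj₁ (T-∧⁻ {2 ≤ᵇ x} bound)))) (map-+2-∸2 xs (proj₂ (T-∧⁻ {2 ≤ᵇ x} bound)))

OddFam-3↔twisted : ∀ dm dn m n → OddFam 3 0 dm dn m n ↔ OddFam 1 2 dm dn m n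
OddFam-3↔twisted dm dn m n = mk↔ₛ′ to from to∘from from∘to
  where
  weightSum-+2 : ∀ σ → weightSum (λ _ → 1) (map (2 +_) σ) ≡ weightSum (λ _ → 1) σ
  weightSum-+2 []       = refl
  weightSum-+2 (_ ∷ xs) = cong suc (weightSum-+2 xs)
  shiftedSum-+2 : ∀ σ → shiftedSum (λ _ → 1) 0 (map (2 +_) σ) ≡ shiftedSum (λ _ → 1) 2 σ
  shiftedSum-+2 []       = refl
  shiftedSum-+2 (x ∷ xs) = cong ((2 + x) +_) (shiftedSum-+2 xs)
  lift : ∀ σ → Fibre (oddFrom 1) (λ _ → 1) 2 dm dn m n σ → Fibre (oddFrom 3) (λ _ → 1) 0 dm dn m n (map (2 +_) σ)
  lift σ (fibre p e₁ e₂) = fibre (subst T (sym (oddFrom-+2 1 σ)) p)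
    (trans (cong (dm +_) (weightSum-+2 σ)) e₁) (trans (cong (dn +_) (shiftedSum-+2 σ)) e₂)
  lower : ∀ σ → Fibre (oddFrom 3) (λ _ → 1) 0 dm dn m n (map (2 +_) σ) → Fibre (oddFrom 1) (λ _ → 1) 2 dm dn m n σ
  lower σ (fibre p e₁ e₂) = fibre (subst T (oddFrom-+2 1 σ) p)
    (trans (cong (dm +_) (sym (weightSum-+2 σ))) e₁) (trans (cong (dn +_) (sym (shiftedSum-+2 σ))) e₂)
  parts≥2 : ∀ ρ → Fibre (oddFrom 3) (λ _ → 1) 0 dm dn m n ρ → T (allB (2 ≤ᵇ_) ρ)
  parts≥2 ρ (fibre p _ _) = allB-≤-mono ρ (s≤s (s≤s z≤n)) (proj₂ (oddFrom⇒oddAtMostTwice 3 ρ p))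
  to : OddFam 3 0 dm dn m n → OddFam 1 2 dm dn m n
  to (ρ , f) = map (_∸ 2) ρ ,
    lower (map (_∸ 2) ρ) (subst (Fibre (oddFrom 3) (λ _ → 1) 0 dm dn m n) (sym (map-+2-∸2 ρ (parts≥2 ρ f))) f)
  from : OddFam 1 2 dm dn m n → OddFam 3 0 dm dn m n
  from (σ , f) = map (2 +_) σ , lift σ f
  to∘from : ∀ b → to (from b) ≡ b
  to∘from (σ , _) = Family-≡ (trans (sym (map-∘ σ)) (map-id σ))
  from∘to : ∀ a → from (to a) ≡ a
  from∘to (ρ , f) = Family-≡ (map-+2-∸2 ρ (parts≥2 ρ f))

-- Schur partitions versus odd partitions

Schur↔Odd-step : ∀ n → (∀ {n′} → n′ < n → ∀ m → SchurFam 1 0 0 0 m n′ ↔ OddFam 1 0 0 0 m n′) →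
                 ∀ m → SchurFam 1 0 0 0 m n ↔ OddFam 1 0 0 0 m n
Schur↔Odd-step n ih m =
  SchurFam-1-split m n
  ⟫ (↔-sym (SchurFam-1-twisted 0 0 m n)
     ⊎-cong (↔-sym (SchurFam-1-twisted 1 1 m n) ⊎-cong ↔-sym (SchurFam-1-twisted 2 2 m n)))
  ⟫ (twist-cong (fibre↔ 0) ⊎-cong (twist-cong (fibre↔ 1) ⊎-cong twist-cong (fibre↔ 2)))
  ⟫ ↔-sym (OddFam-3↔twisted 0 0 m n ⊎-cong (OddFam-3↔twisted 1 1 m n ⊎-cong OddFam-3↔twisted 2 2 m n))
  ⟫ ↔-sym (OddFam-split-ones 0 0 m n)
  where
  fibre↔ : ∀ k m′ n′ → Offset 2 k k m n (m′ , n′) → SchurFam 1 0 0 0 m′ n′ ↔ OddFam 1 0 0 0 m′ n′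
  fibre↔ k zero     n′ _ = Family-weight-zero weight-pos tt ⟫ ↔-sym (Family-weight-zero (λ _ → ≤-refl) tt)
  fibre↔ k (suc m′) n′ (_ , size≡) = ih n′<n (suc m′)
    where
    open ≤-Reasoning
    n′<n : n′ < n
    n′<n = begin-strict
      n′                      <⟨ m<n+m n′ (s≤s z≤n) ⟩
      2 * suc m′ + n′         ≤⟨ m≤n+m _ k ⟩
      k + (2 * suc m′ + n′)   ≡⟨ size≡ ⟩
      n                       ∎

Schur↔Odd : ∀ m n → SchurFam 1 0 0 0 m n ↔ OddFam 1 0 0 0 m n
Schur↔Odd m n = <-rec (λ n → ∀ m → SchurFam 1 0 0 0 m n ↔ OddFam 1 0 0 0 m n) Schur↔Odd-step n m

𝒟*↔twisted : ∀ m n → 𝒟* m n ↔ SchurFam 1 2 0 0 m n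
𝒟*↔twisted m n = 𝒟*↔StarFam m n ⟫ ↔-sym (SchurFam-1-twisted 0 0 m n)

theorem1 : (m n : ℕ) →
    (𝒟* m n ↔ 𝒞* m n)
    × (2 * m ≤ n → 𝒟* m n ↔ 𝒟 m (n ∸ 2 * m))
    × (n < 2 * m → 𝒟* m n ↔ ⊥)
theorem1 m n =
  (𝒟*↔twisted m n
   ⟫ twist-cong (λ m′ n′ _ → Schur↔Odd m′ n′)
   ⟫ ↔-sym (OddFam-3↔twisted 0 0 m n)
   ⟫ ↔-sym (𝒞*↔OddFam m n)) ,
  (λ 2m≤n → 𝒟*↔twisted m n ⟫ Family-untwist 2m≤n ⟫ ↔-sym (𝒟↔SchurFam m (n ∸ 2 * m))) ,
  (λ n<2m → 𝒟*↔twisted m n ⟫ Family-twisted-empty n<2m)
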